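{- Let $G=(V,E,w)$ be a complete graph with non-negative edge weights. Let $V_b$ be the set of vertices belonging to some violating triangle and $V_g=V\setminus V_b$, and assume $\min\{|V_g|,|V_b|\}\ge 3$. Let $o\in V_g$ be arbitrary, let $\mathrm{OPT}$ be the weight of an optimal TSP tour in $G$, and let $T_b^*$ (resp. $T_g^*$) be an optimal TSP tour in the induced subgraph $G[V_b\cup\{o\}]$ (resp. $G[V_g]$). Then $\mathrm{OPT}\ge w(T_b^*)$ and $\mathrm{OPT}\ge w(T_g^*)$.
   Context: A TSP tour in a complete graph is a Hamiltonian cycle; its weight is the sum of its edge weights. A triangle on three distinct vertices $a,b,c$ is violating if the triangle inequality $w(x,y)\le w(x,z)+w(z,y)$ fails for some ordering $(x,y,z)$ of $a,b,c$.
   Formalization: The edge weights are non-negative rationals instead of non-negative reals. -}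

module Defs where

open import Data.Nat using (ℕ)
open import Data.Fin using (Fin)
open import Data.List using (List; []; _∷_)
open import Data.List.Relation.Unary.Unique.Propositional using (Unique)
open import Data.List.Membership.Propositional using (_∈_)
open import Data.Rational using (ℚ; 0ℚ; _+_; _≤_)
open import Data.Product using (_×_; ∃-syntax)
open import Data.Sum using (_⊎_)
open import Data.Unit using (⊤)
open import Relation.Nullary using (¬_)
open import Relation.Binary.PropositionalEquality using (_≡_; _≢_)
open import Function.Bundles using (_⇔_)

-- Weighted complete graph on vertex set Fin n: a weight for each pair.
Weight : ℕ → Set
Weight n = Fin n → Fin n → ℚ

-- Undirected complete graph with non-negative edge weights
-- (weights are only relevant on pairs of distinct vertices).
IsNonNegSymmetric : {n : ℕ} → Weight n → Set
IsNonNegSymmetric {n} w =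
  (∀ (u v : Fin n) → u ≢ v → w u v ≡ w v u) ×
  (∀ (u v : Fin n) → u ≢ v → 0ℚ ≤ w u v)

module _ {n : ℕ} (w : Weight n) where

  TriFails : Fin n → Fin n → Fin n → Set
  TriFails x y z = ¬ (w x y ≤ w x z + w z y)

  Distinct3 : Fin n → Fin n → Fin n → Set
  Distinct3 a b c = a ≢ b × a ≢ c × b ≢ c

  Violating : Fin n → Fin n → Fin n → Set
  Violating a b c = Distinct3 a b c ×
    (TriFails a b c ⊎ TriFails a c b ⊎ TriFails b a c ⊎
     TriFails b c a ⊎ TriFails c a b ⊎ TriFails c b a)

  InVb : Fin n → Set
  InVb v = ∃[ a ] ∃[ b ] Violating v a b

  InVg : Fin n → Set
  InVg v = ¬ InVb v

  private
    pathFrom : Fin n → Fin n → List (Fin n) → ℚ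
    pathFrom first prev []       = w prev first
    pathFrom first prev (v ∷ vs) = w prev v + pathFrom first v vs

  cycleWeight : List (Fin n) → ℚ
  cycleWeight []       = 0ℚ
  cycleWeight (v ∷ vs) = pathFrom v v vs

  -- a TSP tour (Hamiltonian cycle) of the induced subgraph G[S]:
  -- a cyclic sequence listing every vertex of S exactly once
  IsTour : (Fin n → Set) → List (Fin n) → Set
  IsTour S t = Unique t × (∀ v → (v ∈ t) ⇔ S v)

  IsOptimalTour : (Fin n → Set) → List (Fin n) → Set
  IsOptimalTour S t = IsTour S t ×
    (∀ t' → IsTour S t' → cycleWeight t ≤ cycleWeight t')

  AllV : Fin n → Set
  AllV _ = ⊤

  VbPlus : Fin n → Fin n → Set
  VbPlus o v = InVb v ⊎ v ≡ o

{-# OPTIONS --safe #-}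
module Submission where

-- Shortcutting a tour of G past the vertices outside a set K gives a tour of G[K] of no
-- larger weight, as long as w(x,y) ≤ w(x,v) + w(v,y) for distinct x, v, y with x ∈ K and
-- v ∉ K. For K = V_b ∪ {o} the skipped vertex v lies in V_g, and for K = V_g the vertex x
-- does; either way the triangle x v y is not violating. Two distinct vertices of K keep the
-- shortcut cycle from collapsing to a loop at one vertex. Hence only two vertices of each
-- class are used, and neither o ∈ V_g nor the symmetry or non-negativity of w.

open import Defs
open import Algebra.Properties.Group using (∙-cancelˡ)
open import Data.Nat using (ℕ)
open import Data.Fin using (Fin; _≟_)
open import Data.Fin.Properties using (any?)
open import Data.List using (List; []; _∷_; _++_; filter)
open import Data.List.Properties using (++-identityʳ; filter-++; filter-accept)
open import Data.List.Membership.Propositional using (_∈_; _∉_; lose)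
open import Data.List.Membership.Propositional.Properties using (∈-∃++; ∈-filter⁺; ∈-filter⁻)
open import Data.List.Relation.Unary.Any as Any using (Any; here; there)
open import Data.List.Relation.Unary.All using (_∷_)
open import Data.List.Relation.Unary.AllPairs using (_∷_)
open import Data.List.Relation.Unary.Unique.Propositional using (Unique)
open import Data.List.Relation.Unary.Unique.Propositional.Properties using (filter⁺; Unique[x∷xs]⇒x∉xs)
import Data.List.Relation.Binary.Permutation.Setoid as Permutation
import Data.List.Relation.Binary.Permutation.Setoid.Properties as PermutationProperties
open import Data.Rational using (ℚ; _+_; _≤_; _≤?_)
open import Data.Rational.Properties using (≤-refl; ≤-trans; +-assoc; +-comm; +-monoˡ-≤; +-monoʳ-≤; +-0-group; module ≤-Reasoning)
open import Data.Product using (_×_; _,_; proj₂)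
open import Data.Sum using (_⊎_; inj₁; inj₂)
import Data.Sum as Sum
open import Data.Empty using (⊥-elim)
open import Data.Unit using (tt)
open import Function using (_∘_)
open import Function.Bundles using (mk⇔; Equivalence)
open import Relation.Nullary using (¬_; Dec; yes; no)
open import Relation.Nullary.Decidable using (_×-dec_; _⊎-dec_; ¬?; decidable-stable)
open import Relation.Unary using (Decidable)
open import Relation.Binary.PropositionalEquality using (_≡_; _≢_; refl; sym; trans; cong; setoid; module ≡-Reasoning)

module _ {n : ℕ} (w : Weight n) where

  open Permutation (setoid (Fin n)) using (_↭_)
  open PermutationProperties (setoid (Fin n)) using (++-comm; ∈-resp-↭; Unique-resp-↭)

  pathWeight : Fin n → List (Fin n) → Fin n → ℚ
  pathWeight u []       z = w u z
  pathWeight u (v ∷ vs) z = w u v + pathWeight v vs z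

  -- The walk weight inside cycleWeight is private to Defs; it is reached by cancelling the
  -- first edge of a cycle.
  cycleWeight-∷-∷ : ∀ u v vs → cycleWeight w (u ∷ v ∷ vs) ≡ w u v + pathWeight v vs u
  cycleWeight-∷-∷ u v []       = refl
  cycleWeight-∷-∷ u v (x ∷ xs) =
    cong (λ p → w u v + (w v x + p)) (∙-cancelˡ +-0-group (w u x) _ _ (cycleWeight-∷-∷ u x xs))

  cycleWeight≡pathWeight : ∀ u vs → cycleWeight w (u ∷ vs) ≡ pathWeight u vs u
  cycleWeight≡pathWeight u []       = refl
  cycleWeight≡pathWeight u (v ∷ vs) = cycleWeight-∷-∷ u v vs

  pathWeight-++ : ∀ u xs v ys z → pathWeight u (xs ++ v ∷ ys) z ≡ pathWeight u xs v + pathWeight v ys z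
  pathWeight-++ u []       v ys z = refl
  pathWeight-++ u (x ∷ xs) v ys z =
    trans (cong (w u x +_) (pathWeight-++ x xs v ys z)) (sym (+-assoc (w u x) _ _))

  cycleWeight-++-comm : ∀ xs ys → cycleWeight w (xs ++ ys) ≡ cycleWeight w (ys ++ xs)
  cycleWeight-++-comm []       ys       = cong (cycleWeight w) (sym (++-identityʳ ys))
  cycleWeight-++-comm (x ∷ xs) []       = cong (cycleWeight w) (++-identityʳ (x ∷ xs))
  cycleWeight-++-comm (x ∷ xs) (y ∷ ys) = begin
    cycleWeight w (x ∷ xs ++ y ∷ ys)        ≡⟨ cycleWeight≡pathWeight x (xs ++ y ∷ ys) ⟩
    pathWeight x (xs ++ y ∷ ys) x           ≡⟨ pathWeight-++ x xs y ys x ⟩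
    pathWeight x xs y + pathWeight y ys x   ≡⟨ +-comm (pathWeight x xs y) _ ⟩
    pathWeight y ys x + pathWeight x xs y   ≡⟨ sym (pathWeight-++ y ys x xs y) ⟩
    pathWeight y (ys ++ x ∷ xs) y           ≡⟨ sym (cycleWeight≡pathWeight y (ys ++ x ∷ xs)) ⟩
    cycleWeight w (y ∷ ys ++ x ∷ xs)        ∎
    where open ≡-Reasoning

  ShortcutSafe : (Fin n → Set) → Set
  ShortcutSafe K = ∀ {x v y} → K x → ¬ K v → v ≢ y → x ≢ y → w x y ≤ w x v + w v y

  module _ {K : Fin n → Set} (K? : Decidable K) (safe : ShortcutSafe K) where

    pathWeight-skip : ∀ {u v z} vs → K u → ¬ K v → Unique (u ∷ v ∷ vs) → z ∉ v ∷ vs →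
                      u ≢ z ⊎ Any K vs → pathWeight u vs z ≤ w u v + pathWeight v vs z
    pathWeight-skip []       ku ¬kv _ z∉v∷vs (inj₁ u≢z) = safe ku ¬kv (z∉v∷vs ∘ here ∘ sym) u≢z
    pathWeight-skip {u} {v} {z} (y ∷ ys) ku ¬kv ((_ ∷ u≢y ∷ _) ∷ (v≢y ∷ _) ∷ _) _ _ = begin
      w u y + pathWeight y ys z               ≤⟨ +-monoˡ-≤ (pathWeight y ys z) (safe ku ¬kv v≢y u≢y) ⟩
      (w u v + w v y) + pathWeight y ys z     ≡⟨ +-assoc (w u v) (w v y) _ ⟩
      w u v + (w v y + pathWeight y ys z)     ∎
      where open ≤-Reasoning

    -- The invariant u ≢ z ⊎ Any K xs rules out shortcutting a whole cycle down to the loop z z.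
    pathWeight-filter-≤ : ∀ {u z} xs → K u → Unique (u ∷ xs) → z ∉ xs → u ≢ z ⊎ Any K xs →
                          pathWeight u (filter K? xs) z ≤ pathWeight u xs z
    pathWeight-filter-≤ [] _ _ _ _ = ≤-refl
    pathWeight-filter-≤ {u} {z} (v ∷ vs) ku
      unique@((_ ∷ u∉vs) ∷ v∷vs-unique@(_ ∷ vs-unique)) z∉v∷vs apart with K? v
    ... | yes kv = +-monoʳ-≤ (w u v)
      (pathWeight-filter-≤ vs kv v∷vs-unique (z∉v∷vs ∘ there) (inj₁ (z∉v∷vs ∘ here ∘ sym)))
    ... | no ¬kv = ≤-trans
      (pathWeight-filter-≤ vs ku (u∉vs ∷ vs-unique) (z∉v∷vs ∘ there) apart′)
      (pathWeight-skip vs ku ¬kv unique z∉v∷vs apart′)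
      where
      apart′ : u ≢ z ⊎ Any K vs
      apart′ = Sum.map₂ (Any.tail ¬kv) apart

    cycleWeight-filter-≤ : ∀ {a b t} → Unique t → a ∈ t → b ∈ t → a ≢ b → K a → K b →
                           cycleWeight w (filter K? t) ≤ cycleWeight w t
    cycleWeight-filter-≤ {a} {b} t-unique a∈t b∈t a≢b ka kb with R , S , refl ← ∈-∃++ a∈t = begin
      cycleWeight w (filter K? (R ++ a ∷ S))            ≡⟨ cong (cycleWeight w) (filter-++ K? R (a ∷ S)) ⟩
      cycleWeight w (filter K? R ++ filter K? (a ∷ S))  ≡⟨ cycleWeight-++-comm (filter K? R) _ ⟩
      cycleWeight w (filter K? (a ∷ S) ++ filter K? R)  ≡⟨ cong (cycleWeight w) (sym (filter-++ K? (a ∷ S) R)) ⟩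
      cycleWeight w (filter K? (a ∷ S ++ R))            ≡⟨ cong (cycleWeight w) (filter-accept K? ka) ⟩
      cycleWeight w (a ∷ filter K? (S ++ R))            ≡⟨ cycleWeight≡pathWeight a (filter K? (S ++ R)) ⟩
      pathWeight a (filter K? (S ++ R)) a               ≤⟨ shortcut ⟩
      pathWeight a (S ++ R) a                           ≡⟨ sym (cycleWeight≡pathWeight a (S ++ R)) ⟩
      cycleWeight w (a ∷ S ++ R)                        ≡⟨ cycleWeight-++-comm (a ∷ S) R ⟩
      cycleWeight w (R ++ a ∷ S)                        ∎
      where
      open ≤-Reasoning

      rotation : R ++ a ∷ S ↭ a ∷ S ++ R
      rotation = ++-comm R (a ∷ S)

      rotated-unique : Unique (a ∷ S ++ R)
      rotated-unique = Unique-resp-↭ rotation t-unique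

      b∈S++R : b ∈ S ++ R
      b∈S++R with ∈-resp-↭ rotation b∈t
      ... | here b≡a  = ⊥-elim (a≢b (sym b≡a))
      ... | there b∈  = b∈

      shortcut : pathWeight a (filter K? (S ++ R)) a ≤ pathWeight a (S ++ R) a
      shortcut = pathWeight-filter-≤ (S ++ R) ka rotated-unique
        (Unique[x∷xs]⇒x∉xs rotated-unique) (inj₂ (lose b∈S++R kb))

  filter-isTour : ∀ {K t} (K? : Decidable K) → IsTour w (AllV w) t → IsTour w K (filter K? t)
  filter-isTour {t = t} K? (unique , spans) = filter⁺ K? unique ,
    λ v → mk⇔ (proj₂ ∘ ∈-filter⁻ K? {xs = t}) (∈-filter⁺ K? (Equivalence.from (spans v) tt))

  optimalTour≤tour : ∀ {K a b t t*} (K? : Decidable K) → ShortcutSafe K → K a → K b → a ≢ b →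
                     IsTour w (AllV w) t → IsOptimalTour w K t* → cycleWeight w t* ≤ cycleWeight w t
  optimalTour≤tour K? safe ka kb a≢b tour@(unique , spans) (_ , optimal) =
    ≤-trans (optimal _ (filter-isTour K? tour))
            (cycleWeight-filter-≤ K? safe unique (visits _) (visits _) a≢b ka kb)
    where
    visits : ∀ v → v ∈ _
    visits v = Equivalence.from (spans v) tt

  triangle-via-InVg : ∀ {x v y} → InVg w v → Distinct3 w v x y → w x y ≤ w x v + w v y
  triangle-via-InVg {x} {v} {y} good distinct = decidable-stable (w x y ≤? w x v + w v y)
    λ fails → good (x , y , distinct , inj₂ (inj₂ (inj₂ (inj₁ fails))))

  triangle-from-InVg : ∀ {x v y} → InVg w x → Distinct3 w x v y → w x y ≤ w x v + w v y
  triangle-from-InVg {x} {v} {y} good distinct = decidable-stable (w x y ≤? w x v + w v y)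
    λ fails → good (v , y , distinct , inj₂ (inj₁ fails))

  VbPlus-shortcutSafe : ∀ o → ShortcutSafe (VbPlus w o)
  VbPlus-shortcutSafe o kx ¬kv v≢y x≢y = triangle-via-InVg (¬kv ∘ inj₁) ((λ { refl → ¬kv kx }) , v≢y , x≢y)

  InVg-shortcutSafe : ShortcutSafe (InVg w)
  InVg-shortcutSafe kx ¬kv v≢y x≢y = triangle-from-InVg kx ((λ { refl → ¬kv kx }) , x≢y , v≢y)

  InVb? : Decidable (InVb w)
  InVb? v = any? λ a → any? λ b → violating? v a b
    where
    triFails? : ∀ x y z → Dec (TriFails w x y z)
    triFails? x y z = ¬? (w x y ≤? w x z + w z y)

    violating? : ∀ a b c → Dec (Violating w a b c)
    violating? a b c = (¬? (a ≟ b) ×-dec ¬? (a ≟ c) ×-dec ¬? (b ≟ c)) ×-dec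
      (triFails? a b c ⊎-dec triFails? a c b ⊎-dec triFails? b a c ⊎-dec
       triFails? b c a ⊎-dec triFails? c a b ⊎-dec triFails? c b a)

lemma1 : (n : ℕ) (w : Weight n) → IsNonNegSymmetric w →
    (g₁ g₂ g₃ : Fin n) → InVg w g₁ → InVg w g₂ → InVg w g₃ → Distinct3 w g₁ g₂ g₃ →
    (b₁ b₂ b₃ : Fin n) → InVb w b₁ → InVb w b₂ → InVb w b₃ → Distinct3 w b₁ b₂ b₃ →
    (o : Fin n) → InVg w o →
    (T Tb Tg : List (Fin n)) →
    IsOptimalTour w (AllV w) T →
    IsOptimalTour w (VbPlus w o) Tb →
    IsOptimalTour w (InVg w) Tg →
    (cycleWeight w Tb ≤ cycleWeight w T) × (cycleWeight w Tg ≤ cycleWeight w T)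
lemma1 _ w _ _ _ _ good₁ good₂ _ (g₁≢g₂ , _) _ _ _ bad₁ bad₂ _ (b₁≢b₂ , _) o _
       _ _ _ (tour , _) optimalB optimalG =
  optimalTour≤tour w VbPlus? (VbPlus-shortcutSafe w o) (inj₁ bad₁) (inj₁ bad₂) b₁≢b₂ tour optimalB ,
  optimalTour≤tour w InVg? (InVg-shortcutSafe w) good₁ good₂ g₁≢g₂ tour optimalG
  where
  VbPlus? : Decidable (VbPlus w o)
  VbPlus? v = InVb? w v ⊎-dec v ≟ o

  InVg? : Decidable (InVg w)
  InVg? v = ¬? (InVb? w v)
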